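{- Fix an integer $d\ge2$. There exist constants $c_d>0$ and $\bar\rho_d<2$ such that for every $m\in\mathbb N$, every $\alpha\in\mathcal S_d$ and every $r\ge 0$, $$\left| B(\alpha;2^rm,2^r(m+1)) - \frac{2^r}{N_d}\right| < c_d\,\bar\rho_d^{\,r}.$$
   Context: The Stern sequence $(s(n))_{n\ge0}$ is defined by $s(0)=0$, $s(1)=1$, $s(2n)=s(n)$, $s(2n+1)=s(n)+s(n+1)$. For an integer $d\ge2$, let $S_d(n)=(s(n)\bmod d,\ s(n+1)\bmod d)$, and let $\mathcal S_d=\{(i\bmod d, j\bmod d): \gcd(i,j,d)=1\}$; $N_d=|\mathcal S_d|$. For $\gamma\in\mathcal S_d$ and integers $U_1<U_2$, let $B(\gamma;U_1,U_2)=|\{m: U_1\le m<U_2,\ S_d(m)=\gamma\}|$. -}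

module Defs where

open import Data.Nat as ℕ using (ℕ; zero; suc; _+_; _*_; _∸_; _≟_)
open import Data.Nat.DivMod using (_/_; _%_)
open import Data.Nat.GCD using (gcd)
open import Data.Bool using (if_then_else_)
open import Data.Product using (_×_; _,_)
open import Data.List using (List; length; filter; upTo; applyUpTo; cartesianProduct)
open import Relation.Nullary.Decidable using (_×-dec_; does)
open import Data.Integer using () renaming (+_ to ℤ+)
open import Relation.Binary.PropositionalEquality using (_≡_)
open import Data.Rational as ℚ using (ℚ; 0ℚ; 1ℚ)

-- Stern sequence, computed with fuel (the recursion halves the argument).
-- sternFuel f n = s(n) whenever f > n.
sternFuel : ℕ → ℕ → ℕ
sternFuel zero          _               = 0
sternFuel (suc f)       zero            = 0
sternFuel (suc f)       (suc zero)      = 1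
sternFuel (suc f) n@(suc (suc _)) =
  if does ((n % 2) ≟ 0)
  then sternFuel f (n / 2)
  else sternFuel f (n / 2) + sternFuel f (suc (n / 2))

stern : ℕ → ℕ
stern n = sternFuel (suc n) n

S : (d : ℕ) → .{{ℕ.NonZero d}} → ℕ → ℕ × ℕ
S d n = (stern n % d , stern (suc n) % d)

inSd : ℕ → ℕ → ℕ → Set
inSd d i j = gcd (gcd i j) d ≡ 1

N : ℕ → ℕ
N d = length (filter (λ p → gcd (gcd (Data.Product.proj₁ p) (Data.Product.proj₂ p)) d ≟ 1)
                     (cartesianProduct (upTo d) (upTo d)))

B : (d : ℕ) → .{{ℕ.NonZero d}} → ℕ → ℕ → ℕ → ℕ → ℕ
B d a b U₁ U₂ =
  length (filter (λ m → (Data.Product.proj₁ (S d m) ≟ a) ×-dec (Data.Product.proj₂ (S d m) ≟ b))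
                 (applyUpTo (λ k → U₁ + k) (U₂ ∸ U₁)))

-- natural-number quotient as a rational (n ÷ 0 := 0; only used with N_d ≥ 1)
_÷_ : ℕ → ℕ → ℚ
n ÷ zero  = 0ℚ
n ÷ suc k = (ℤ+ n) ℚ./ suc k

_^ℚ_ : ℚ → ℕ → ℚ
q ^ℚ zero  = 1ℚ
q ^ℚ suc r = q ℚ.* (q ^ℚ r)

-- Write γₙ = S_d(n). Since s(2n) = s(n) and s(2n+1) = s(n) + s(n+1), we have γ₂ₙ = L γₙ and
-- γ₂ₙ₊₁ = R γₙ for L(a, b) = (a, a + b) and R(a, b) = (a + b, b) on (ℤ/d)². Hence the number of
-- m ∈ [2ʳn, 2ʳ(n+1)) with γₘ = α is (Tʳδ_α)(γₙ), where (T h)(γ) = h(Lγ) + h(Rγ). As L and R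
-- permute 𝒮_d, Tʳδ_α sums to 2ʳ over 𝒮_d. Subtractive Euclid (blocks of d − 1 steps L or R)
-- joins every state of 𝒮_d to the L-fixed state (0, 1) by a walk of one common length K; since
-- one of the 2ᴷ summands of (Tᴷh)(γ) is then h(0, 1), Tᴷ shrinks the oscillation of h on 𝒮_d by
-- the factor 2ᴷ − 1. So Tʳδ_α is within (2ᴷ − 1)^⌊r/K⌋·2^(r mod K) of its mean 2ʳ/N_d, and
-- Bernoulli's inequality bounds this by (2ᴷ + 1)ρʳ with ρ = (2M + 1)/(M + 1) < 2, M = K·2ᴷ.

module Submission where

open import Defs
open import Data.Nat hiding (_/_; ∣_-_∣)
import Data.Nat as ℕ
open import Data.Nat.Properties
open import Data.Nat.DivMod
  using ( m*n%n≡0; m*n/n≡m; [m+kn]%n≡m%n; [m+n]%n≡m%n; +-distrib-/-∣ʳ; %-distribˡ-+; m%n%n≡m%n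
        ; m<n⇒m%n≡m; m%n<n; m≡m%n+[m/n]*n)
open import Data.Nat.Divisibility
  using (_∣_; divides-refl; ∣-trans; ∣-antisym; ∣m+n∣m⇒∣n; ∣m∸n∣n⇒∣m; ∣m∣n⇒∣m+n; ∣n∣m%n⇒∣m
        ; %-presˡ-∣)
open import Data.Nat.GCD
  using ( gcd; gcd[m,n]∣m; gcd[m,n]∣n; gcd-greatest; gcd-comm; gcd-identityˡ; gcd-identityʳ; gcd-zeroˡ
        ; gcd[m,n]≤n)
open import Data.Nat.Induction using (<-rec)
open import Data.Nat.GeneralisedArithmetic using (iterate)
open import Data.Nat.ListAction using (sum)
open import Data.Nat.ListAction.Properties using (sum-++)
open import Data.Nat.Tactic.RingSolver using (solve-∀)
open import Data.List using (_∷_; []; _++_; map; applyUpTo; upTo; filter; length; cartesianProduct)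
open import Data.List.Properties using (map-++; map-∘; map-cong; map-upTo; map-applyUpTo)
open import Data.Product using (Σ; ∃-syntax; _×_; _,_; proj₁; proj₂; swap)
open import Data.Sum using (inj₁; inj₂)
open import Data.Bool using (true; false; if_then_else_)
open import Data.Integer using (+_)
import Data.Integer as ℤ
import Data.Integer.Properties as ℤ
open import Data.Rational using (ℚ; 0ℚ; _-_; ∣_∣; _/_) renaming (_<_ to _<ℚ_; _*_ to _*ℚ_)
import Data.Rational as ℚ
import Data.Rational.Properties as ℚ
import Data.Rational.Unnormalised as ℚᵘ
import Data.Rational.Unnormalised.Properties as ℚᵘ
open import Algebra.Properties.AbelianGroup ℚ.+-0-abelianGroup using (⁻¹-anti-homo‿-)
open import Relation.Nullary using (Dec; yes; no; does; _×-dec_; contradiction)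
open import Relation.Unary using (Pred; Decidable)
open import Relation.Binary.PropositionalEquality
open import Function using (_∘_)

∑< : ℕ → (ℕ → ℕ) → ℕ
∑< n f = sum (applyUpTo f n)

syntax ∑< n (λ i → x) = ∑[ i < n ] x

∑-cong : ∀ n {f g : ℕ → ℕ} → (∀ {i} → i < n → f i ≡ g i) → ∑< n f ≡ ∑< n g
∑-cong zero    f≗g = refl
∑-cong (suc n) f≗g = cong₂ _+_ (f≗g z<s) (∑-cong n (f≗g ∘ s<s))

∑-mono-≤ : ∀ n {f g : ℕ → ℕ} → (∀ {i} → i < n → f i ≤ g i) → ∑< n f ≤ ∑< n g
∑-mono-≤ zero    f≤g = z≤n
∑-mono-≤ (suc n) f≤g = +-mono-≤ (f≤g z<s) (∑-mono-≤ n (f≤g ∘ s<s))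

∑-term-≤ : ∀ n (f : ℕ → ℕ) {i} → i < n → f i ≤ ∑< n f
∑-term-≤ (suc n) f {zero}  _         = m≤m+n (f 0) _
∑-term-≤ (suc n) f {suc i} (s<s i<n) = ≤-trans (∑-term-≤ n (f ∘ suc) i<n) (m≤n+m _ (f 0))

∑-zero : ∀ n → ∑[ i < n ] 0 ≡ 0
∑-zero zero    = refl
∑-zero (suc n) = ∑-zero n

∑-distrib-+ : ∀ n (f g : ℕ → ℕ) → ∑[ i < n ] (f i + g i) ≡ ∑< n f + ∑< n g
∑-distrib-+ zero    f g = refl
∑-distrib-+ (suc n) f g = begin
  f 0 + g 0 + ∑[ i < n ] (f (suc i) + g (suc i))  ≡⟨ cong (_+_ (f 0 + g 0)) (∑-distrib-+ n (f ∘ suc) (g ∘ suc)) ⟩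
  f 0 + g 0 + (∑< n (f ∘ suc) + ∑< n (g ∘ suc))  ≡⟨ interchange (f 0) (g 0) _ _ ⟩
  f 0 + ∑< n (f ∘ suc) + (g 0 + ∑< n (g ∘ suc))  ∎
  where
  open ≡-Reasoning
  interchange : ∀ a b c e → a + b + (c + e) ≡ a + c + (b + e)
  interchange = solve-∀

*-distribˡ-∑ : ∀ n c (f : ℕ → ℕ) → c * ∑< n f ≡ ∑[ i < n ] (c * f i)
*-distribˡ-∑ zero    c f = *-zeroʳ c
*-distribˡ-∑ (suc n) c f =
  trans (*-distribˡ-+ c (f 0) _) (cong (_+_ (c * f 0)) (*-distribˡ-∑ n c (f ∘ suc)))

∑-comm : ∀ m n (f : ℕ → ℕ → ℕ) → ∑[ i < m ] ∑[ j < n ] f i j ≡ ∑[ j < n ] ∑[ i < m ] f i j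
∑-comm zero    n f = sym (∑-zero n)
∑-comm (suc m) n f = trans (cong (_+_ (∑< n (f 0))) (∑-comm m n (f ∘ suc)))
                           (sym (∑-distrib-+ n (f 0) (λ j → ∑[ i < m ] f (suc i) j)))

∑-+ : ∀ m n (f : ℕ → ℕ) → ∑< (m + n) f ≡ ∑< m f + ∑[ i < n ] f (m + i)
∑-+ zero    n f = refl
∑-+ (suc m) n f = trans (cong (_+_ (f 0)) (∑-+ m n (f ∘ suc))) (sym (+-assoc (f 0) _ _))

∑-shift : ∀ n (G : ℕ → ℕ) → ∑[ i < n ] G (suc i) + G 0 ≡ G n + ∑< n G
∑-shift zero    G = +-comm 0 (G 0)
∑-shift (suc n) G = begin
  G 1 + ∑[ i < n ] G (suc (suc i)) + G 0    ≡⟨ rotate (G 1) _ (G 0) ⟩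
  ∑[ i < n ] G (suc (suc i)) + G 1 + G 0    ≡⟨ cong (_+ G 0) (∑-shift n (G ∘ suc)) ⟩
  G (suc n) + ∑[ i < n ] G (suc i) + G 0    ≡⟨ +-assoc (G (suc n)) _ (G 0) ⟩
  G (suc n) + (∑[ i < n ] G (suc i) + G 0)  ≡⟨ cong (_+_ (G (suc n))) (+-comm _ (G 0)) ⟩
  G (suc n) + (G 0 + ∑[ i < n ] G (suc i))  ∎
  where
  open ≡-Reasoning
  rotate : ∀ a b c → a + b + c ≡ b + a + c
  rotate = solve-∀

∑-periodic : ∀ n a (G : ℕ → ℕ) → (∀ x → G (n + x) ≡ G x) → ∑[ i < n ] G (a + i) ≡ ∑< n G
∑-periodic n zero    G periodic = refl
∑-periodic n (suc a) G periodic = begin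
  ∑[ i < n ] G (suc a + i)  ≡⟨ ∑-cong n (λ {i} _ → cong G (sym (+-suc a i))) ⟩
  ∑[ i < n ] G (a + suc i)  ≡⟨ +-cancelʳ-≡ (G a) _ _ shift ⟩
  ∑[ i < n ] G (a + i)      ≡⟨ ∑-periodic n a G periodic ⟩
  ∑< n G                    ∎
  where
  open ≡-Reasoning
  Gₐ : ℕ → ℕ
  Gₐ i = G (a + i)
  shift : ∑[ i < n ] Gₐ (suc i) + G a ≡ ∑< n Gₐ + G a
  shift = begin
    ∑[ i < n ] Gₐ (suc i) + G a    ≡⟨ cong (λ x → ∑[ i < n ] Gₐ (suc i) + G x) (sym (+-identityʳ a)) ⟩
    ∑[ i < n ] Gₐ (suc i) + Gₐ 0   ≡⟨ ∑-shift n Gₐ ⟩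
    Gₐ n + ∑< n Gₐ                 ≡⟨ cong (_+ ∑< n Gₐ) (trans (cong G (+-comm a n)) (periodic a)) ⟩
    G a + ∑< n Gₐ                  ≡⟨ +-comm (G a) _ ⟩
    ∑< n Gₐ + G a                  ∎

∑-rotate : ∀ d .{{_ : NonZero d}} a (F : ℕ → ℕ) → ∑[ b < d ] F ((a + b) % d) ≡ ∑< d F
∑-rotate d a F = begin
  ∑[ b < d ] F ((a + b) % d)  ≡⟨ ∑-periodic d a (F ∘ (_% d)) (λ x → cong F [d+x]%d≡x%d) ⟩
  ∑[ b < d ] F (b % d)        ≡⟨ ∑-cong d (λ b<d → cong F (m<n⇒m%n≡m b<d)) ⟩
  ∑< d F                      ∎
  where
  open ≡-Reasoning
  [d+x]%d≡x%d : ∀ {x} → (d + x) % d ≡ x % d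
  [d+x]%d≡x%d {x} = trans (cong (_% d) (+-comm d x)) ([m+n]%n≡m%n x d)

𝟙 : ∀ {p} {P : Set p} → Dec P → ℕ
𝟙 P? = if does P? then 1 else 0

𝟙≤1 : ∀ {p} {P : Set p} (P? : Dec P) → 𝟙 P? ≤ 1
𝟙≤1 (yes _) = ≤-refl
𝟙≤1 (no _)  = z≤n

𝟙-yes : ∀ {p} {P : Set p} (P? : Dec P) → P → 𝟙 P? ≡ 1
𝟙-yes (yes _) _ = refl
𝟙-yes (no ¬p) p = contradiction p ¬p

𝟙-×-dec : ∀ {p q} {P : Set p} {Q : Set q} (P? : Dec P) (Q? : Dec Q) → 𝟙 (P? ×-dec Q?) ≡ 𝟙 P? * 𝟙 Q?
𝟙-×-dec (yes _) (yes _) = refl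
𝟙-×-dec (yes _) (no _)  = refl
𝟙-×-dec (no _)  _       = refl

𝟙*-mono-≤ : ∀ {p} {P : Set p} (P? : Dec P) {x y} → (P → x ≤ y) → 𝟙 P? * x ≤ 𝟙 P? * y
𝟙*-mono-≤ (yes p) x≤y = *-monoʳ-≤ 1 (x≤y p)
𝟙*-mono-≤ (no _)  _   = z≤n

*-𝟙-absorb : ∀ {p} {P : Set p} (P? : Dec P) {x} → (P → x ≡ 1) → x * 𝟙 P? ≡ 𝟙 P?
*-𝟙-absorb (yes p) {x} x≡1 = trans (*-identityʳ x) (x≡1 p)
*-𝟙-absorb (no _)  {x} _   = *-zeroʳ x

∑-indicator : ∀ n {j} → j < n → ∑[ i < n ] 𝟙 (i ≟ j) ≡ 1
∑-indicator (suc n) {zero}  _         = cong suc (∑-zero n)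
∑-indicator (suc n) {suc j} (s<s j<n) = ∑-indicator n j<n

length-filter : ∀ {a ℓ} {A : Set a} {P : Pred A ℓ} (P? : Decidable P) xs →
                length (filter P? xs) ≡ sum (map (𝟙 ∘ P?) xs)
length-filter P? []       = refl
length-filter P? (x ∷ xs) with does (P? x)
... | true  = cong suc (length-filter P? xs)
... | false = length-filter P? xs

sum-map-cartesianProduct : ∀ {a b} {A : Set a} {B : Set b} (h : A × B → ℕ) xs ys →
  sum (map h (cartesianProduct xs ys)) ≡ sum (map (λ x → sum (map (λ y → h (x , y)) ys)) xs)
sum-map-cartesianProduct h []       ys = refl
sum-map-cartesianProduct h (x ∷ xs) ys = begin
  sum (map h (map (x ,_) ys ++ cartesianProduct xs ys))
    ≡⟨ cong sum (map-++ h (map (x ,_) ys) _) ⟩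
  sum (map h (map (x ,_) ys) ++ map h (cartesianProduct xs ys))
    ≡⟨ sum-++ (map h (map (x ,_) ys)) _ ⟩
  sum (map h (map (x ,_) ys)) + sum (map h (cartesianProduct xs ys))
    ≡⟨ cong₂ _+_ (cong sum (sym (map-∘ ys))) (sum-map-cartesianProduct h xs ys) ⟩
  sum (map (λ y → h (x , y)) ys) + sum (map (λ x → sum (map (λ y → h (x , y)) ys)) xs)
    ∎
  where open ≡-Reasoning

[m+n%d]%d≡[m+n]%d : ∀ m n d .{{_ : NonZero d}} → (m + n % d) % d ≡ (m + n) % d
[m+n%d]%d≡[m+n]%d m n d = begin
  (m + n % d) % d          ≡⟨ %-distribˡ-+ m (n % d) d ⟩
  (m % d + n % d % d) % d  ≡⟨ cong (λ x → (m % d + x) % d) (m%n%n≡m%n n d) ⟩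
  (m % d + n % d) % d      ≡⟨ %-distribˡ-+ m n d ⟨
  (m + n) % d              ∎
  where open ≡-Reasoning

gcd[m∸n,n]≡gcd[m,n] : ∀ {m n} → n ≤ m → gcd (m ∸ n) n ≡ gcd m n
gcd[m∸n,n]≡gcd[m,n] {m} {n} n≤m = ∣-antisym
  (gcd-greatest (∣m∸n∣n⇒∣m _ n≤m (gcd[m,n]∣m (m ∸ n) n) (gcd[m,n]∣n (m ∸ n) n)) (gcd[m,n]∣n (m ∸ n) n))
  (gcd-greatest (∣m+n∣m⇒∣n (subst (gcd m n ∣_) (sym (m+[n∸m]≡n n≤m)) (gcd[m,n]∣m m n)) (gcd[m,n]∣n m n))
                (gcd[m,n]∣n m n))

gcd[m,n∸m]≡gcd[m,n] : ∀ {m n} → m ≤ n → gcd m (n ∸ m) ≡ gcd m n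
gcd[m,n∸m]≡gcd[m,n] {m} {n} m≤n =
  trans (gcd-comm m (n ∸ m)) (trans (gcd[m∸n,n]≡gcd[m,n] m≤n) (gcd-comm n m))

gcd₃ : ℕ → ℕ → ℕ → ℕ
gcd₃ a b c = gcd (gcd a b) c

gcd₃-comm : ∀ a b c → gcd₃ a b c ≡ gcd₃ b a c
gcd₃-comm a b c = cong (λ g → gcd g c) (gcd-comm a b)

gcd₃-divides : ∀ {a b a′ b′} c → (∀ {k} → k ∣ a → k ∣ b → k ∣ c → (k ∣ a′) × (k ∣ b′)) →
               gcd₃ a b c ∣ gcd₃ a′ b′ c
gcd₃-divides {a} {b} {a′} {b′} c common =
  gcd-greatest (gcd-greatest (proj₁ g∣a′b′) (proj₂ g∣a′b′)) (gcd[m,n]∣n (gcd a b) c)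
  where
  g∣a′b′ : (gcd₃ a b c ∣ a′) × (gcd₃ a b c ∣ b′)
  g∣a′b′ = common (∣-trans (gcd[m,n]∣m (gcd a b) c) (gcd[m,n]∣m a b))
                  (∣-trans (gcd[m,n]∣m (gcd a b) c) (gcd[m,n]∣n a b))
                  (gcd[m,n]∣n (gcd a b) c)

gcd₃-+-% : ∀ a b c .{{_ : NonZero c}} → gcd₃ a ((a + b) % c) c ≡ gcd₃ a b c
gcd₃-+-% a b c = ∣-antisym
  (gcd₃-divides {a} {(a + b) % c} c λ k∣a k∣[a+b]%c k∣c →
     k∣a , ∣m+n∣m⇒∣n (∣n∣m%n⇒∣m k∣c k∣[a+b]%c) k∣a)
  (gcd₃-divides {a} {b} c λ k∣a k∣b k∣c →
     k∣a , %-presˡ-∣ (∣m∣n⇒∣m+n k∣a k∣b) k∣c)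

-- The Stern sequence

data EvenOdd : ℕ → Set where
  even : ∀ k → EvenOdd (k * 2)
  odd  : ∀ k → EvenOdd (suc (k * 2))

evenOdd : ∀ n → EvenOdd n
evenOdd zero = even 0
evenOdd (suc n) with evenOdd n
... | even k = odd k
... | odd k  = even (suc k)

[1+n*2]/2≡n : ∀ n → (1 + n * 2) ℕ./ 2 ≡ n
[1+n*2]/2≡n n = trans (+-distrib-/-∣ʳ 1 {d = 2} (divides-refl n)) (m*n/n≡m n 2)

sternFuel-even : ∀ f k → sternFuel (suc f) (suc k * 2) ≡ sternFuel f (suc k)
sternFuel-even f k rewrite m*n%n≡0 k 2 ⦃ _ ⦄ | m*n/n≡m (suc k) 2 ⦃ _ ⦄ = refl

sternFuel-odd : ∀ f k → sternFuel (suc f) (suc (suc k * 2)) ≡ sternFuel f (suc k) + sternFuel f (suc (suc k))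
sternFuel-odd f k rewrite [m+kn]%n≡m%n 1 k 2 ⦃ _ ⦄ | [1+n*2]/2≡n (suc k) = refl

sternFuel-stable : ∀ {f g} n → n < f → n < g → sternFuel f n ≡ sternFuel g n
sternFuel-stable {suc f} {suc g} n n<f n<g with evenOdd n
... | even zero    = refl
... | odd zero     = refl
... | even (suc k) = begin
  sternFuel (suc f) (suc k * 2)  ≡⟨ sternFuel-even f k ⟩
  sternFuel f (suc k)            ≡⟨ sternFuel-stable (suc k) (1+k<f n<f) (1+k<f n<g) ⟩
  sternFuel g (suc k)            ≡⟨ sternFuel-even g k ⟨
  sternFuel (suc g) (suc k * 2)  ∎
  where
  open ≡-Reasoning
  1+k<f : ∀ {f} → suc k * 2 < suc f → 1 + k < f
  1+k<f (s<s (s<s k*2<f)) = s<s (≤-<-trans (m≤m*n k 2) k*2<f)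
... | odd (suc k) = begin
  sternFuel (suc f) (suc (suc k * 2))              ≡⟨ sternFuel-odd f k ⟩
  sternFuel f (suc k) + sternFuel f (suc (suc k))  ≡⟨ cong₂ _+_ (sternFuel-stable (suc k) (1+k<f n<f) (1+k<f n<g))
                                                                (sternFuel-stable (suc (suc k)) (2+k<f n<f) (2+k<f n<g)) ⟩
  sternFuel g (suc k) + sternFuel g (suc (suc k))  ≡⟨ sternFuel-odd g k ⟨
  sternFuel (suc g) (suc (suc k * 2))              ∎
  where
  open ≡-Reasoning
  2+k<f : ∀ {f} → suc (suc k * 2) < suc f → 2 + k < f
  2+k<f (s<s (s<s (s<s k*2<f))) = s<s (s<s (≤-<-trans (m≤m*n k 2) k*2<f))
  1+k<f : ∀ {f} → suc (suc k * 2) < suc f → 1 + k < f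
  1+k<f = <-trans (n<1+n _) ∘ 2+k<f

stern-double : ∀ n → stern (n * 2) ≡ stern n
stern-double zero    = refl
stern-double (suc k) =
  trans (sternFuel-even (suc k * 2) k) (sternFuel-stable (suc k) (s<s (s≤s (m≤m*n k 2))) ≤-refl)

stern-double+1 : ∀ n → stern (suc (n * 2)) ≡ stern n + stern (suc n)
stern-double+1 zero    = refl
stern-double+1 (suc k) = trans (sternFuel-odd (suc (suc k * 2)) k)
  (cong₂ _+_ (sternFuel-stable (suc k) (s<s (s≤s (m≤n⇒m≤1+n (m≤m*n k 2)))) ≤-refl)
             (sternFuel-stable (suc (suc k)) (s<s (s<s (s≤s (m≤m*n k 2)))) ≤-refl))

-- Walks and the transfer operator

module Transfer {S : Set} (L R : S → S) where

  T^ : ℕ → (S → ℕ) → S → ℕ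
  T^ zero    h γ = h γ
  T^ (suc r) h γ = T^ r h (L γ) + T^ r h (R γ)

  T^-+ : ∀ k r h γ → T^ (k + r) h γ ≡ T^ k (T^ r h) γ
  T^-+ zero    r h γ = refl
  T^-+ (suc k) r h γ = cong₂ _+_ (T^-+ k r h (L γ)) (T^-+ k r h (R γ))

  infixr 5 L∷_ R∷_ _++ʷ_

  data Walk : S → S → ℕ → Set where
    []  : ∀ {γ} → Walk γ γ 0
    L∷_ : ∀ {γ β n} → Walk (L γ) β n → Walk γ β (suc n)
    R∷_ : ∀ {γ β n} → Walk (R γ) β n → Walk γ β (suc n)

  _++ʷ_ : ∀ {γ β δ m n} → Walk γ β m → Walk β δ n → Walk γ δ (m + n)
  []     ++ʷ w′ = w′
  (L∷ w) ++ʷ w′ = L∷ (w ++ʷ w′)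
  (R∷ w) ++ʷ w′ = R∷ (w ++ʷ w′)

  walk-L^ : ∀ k γ → Walk γ (iterate L γ k) k
  walk-L^ zero    γ = []
  walk-L^ (suc k) γ = L∷ walk-L^ k (L γ)

  walk-R^ : ∀ k γ → Walk γ (iterate R γ k) k
  walk-R^ zero    γ = []
  walk-R^ (suc k) γ = R∷ walk-R^ k (R γ)

  _⇝[≤_]_ : S → ℕ → S → Set
  γ ⇝[≤ n ] β = ∃[ k ] k ≤ n × Walk γ β k

  infixr 5 _⇝++_

  _⇝++_ : ∀ {γ β δ m n} → γ ⇝[≤ m ] β → β ⇝[≤ n ] δ → γ ⇝[≤ m + n ] δ
  (k , k≤m , w) ⇝++ (k′ , k′≤n , w′) = k + k′ , +-mono-≤ k≤m k′≤n , w ++ʷ w′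

  ⇝-weaken : ∀ {γ β m n} → m ≤ n → γ ⇝[≤ m ] β → γ ⇝[≤ n ] β
  ⇝-weaken m≤n (k , k≤m , w) = k , ≤-trans k≤m m≤n , w

  walk⇒⇝ : ∀ {γ β n} → Walk γ β n → γ ⇝[≤ n ] β
  walk⇒⇝ w = _ , ≤-refl , w

  walk-fixedPoint : ∀ {β} → L β ≡ β → ∀ n → Walk β β n
  walk-fixedPoint         Lβ≡β zero    = []
  walk-fixedPoint {β = β} Lβ≡β (suc n) =
    L∷ subst (λ γ → Walk γ β n) (sym Lβ≡β) (walk-fixedPoint Lβ≡β n)

  pad : ∀ {γ β n} → L β ≡ β → γ ⇝[≤ n ] β → Walk γ β n
  pad Lβ≡β (k , k≤n , w) = subst (Walk _ _) (m+[n∸m]≡n k≤n) (w ++ʷ walk-fixedPoint Lβ≡β _)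

  module Oscillation (P : S → Set) (P-L : ∀ {γ} → P γ → P (L γ))
                     (P-R : ∀ {γ} → P γ → P (R γ)) where

    private
      m+n+o≡m+o+n : ∀ m n o → m + n + o ≡ m + o + n
      m+n+o≡m+o+n = solve-∀
      m+n+o≡n+o+m : ∀ m n o → m + n + o ≡ n + o + m
      m+n+o≡n+o+m = solve-∀
      m+n*o+n*o≡m+2*n*o : ∀ m n o → m + n * o + n * o ≡ m + 2 * n * o
      m+n*o+n*o≡m+2*n*o = solve-∀

    Bounded : ℕ → ℕ → (S → ℕ) → Set
    Bounded lo hi h = ∀ {γ} → P γ → lo ≤ h γ × h γ ≤ hi

    T^-bounded : ∀ {lo hi h} k → Bounded lo hi h → Bounded (2 ^ k * lo) (2 ^ k * hi) (T^ k h)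
    T^-bounded {lo} {hi} zero    bd p rewrite *-identityˡ lo | *-identityˡ hi = bd p
    T^-bounded {lo} {hi} {h} (suc k) bd {γ} p =
      subst (_≤ T^ (suc k) h γ) (double (2 ^ k) lo) (+-mono-≤ (proj₁ (IH (P-L p))) (proj₁ (IH (P-R p)))) ,
      subst (T^ (suc k) h γ ≤_) (double (2 ^ k) hi) (+-mono-≤ (proj₂ (IH (P-L p))) (proj₂ (IH (P-R p))))
      where
      IH : Bounded (2 ^ k * lo) (2 ^ k * hi) (T^ k h)
      IH = T^-bounded k bd
      double : ∀ a x → a * x + a * x ≡ 2 * a * x
      double = solve-∀

    walk-upper : ∀ {lo hi h γ β k} → Bounded lo hi h → P γ → Walk γ β k →
                 T^ k h γ + hi ≤ h β + 2 ^ k * hi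
    walk-upper {hi = hi} {h} bd p [] = ≤-reflexive (cong (_+_ (h _)) (sym (*-identityˡ hi)))
    walk-upper {hi = hi} {h} {γ} {β} {suc k} bd p (L∷ w) = begin
      T^ k h (L γ) + T^ k h (R γ) + hi  ≡⟨ m+n+o≡m+o+n (T^ k h (L γ)) (T^ k h (R γ)) hi ⟩
      T^ k h (L γ) + hi + T^ k h (R γ)  ≤⟨ +-mono-≤ (walk-upper bd (P-L p) w) (proj₂ (T^-bounded k bd (P-R p))) ⟩
      h β + 2 ^ k * hi + 2 ^ k * hi     ≡⟨ m+n*o+n*o≡m+2*n*o (h β) (2 ^ k) hi ⟩
      h β + 2 ^ suc k * hi              ∎
      where open ≤-Reasoning
    walk-upper {hi = hi} {h} {γ} {β} {suc k} bd p (R∷ w) = begin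
      T^ k h (L γ) + T^ k h (R γ) + hi  ≡⟨ m+n+o≡n+o+m (T^ k h (L γ)) (T^ k h (R γ)) hi ⟩
      T^ k h (R γ) + hi + T^ k h (L γ)  ≤⟨ +-mono-≤ (walk-upper bd (P-R p) w) (proj₂ (T^-bounded k bd (P-L p))) ⟩
      h β + 2 ^ k * hi + 2 ^ k * hi     ≡⟨ m+n*o+n*o≡m+2*n*o (h β) (2 ^ k) hi ⟩
      h β + 2 ^ suc k * hi              ∎
      where open ≤-Reasoning

    walk-lower : ∀ {lo hi h γ β k} → Bounded lo hi h → P γ → Walk γ β k →
                 h β + 2 ^ k * lo ≤ T^ k h γ + lo
    walk-lower {lo} {h = h} bd p [] = ≤-reflexive (cong (_+_ (h _)) (*-identityˡ lo))
    walk-lower {lo} {h = h} {γ} {β} {suc k} bd p (L∷ w) = begin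
      h β + 2 ^ suc k * lo              ≡⟨ m+n*o+n*o≡m+2*n*o (h β) (2 ^ k) lo ⟨
      h β + 2 ^ k * lo + 2 ^ k * lo     ≤⟨ +-mono-≤ (walk-lower bd (P-L p) w) (proj₁ (T^-bounded k bd (P-R p))) ⟩
      T^ k h (L γ) + lo + T^ k h (R γ)  ≡⟨ m+n+o≡m+o+n (T^ k h (L γ)) (T^ k h (R γ)) lo ⟨
      T^ k h (L γ) + T^ k h (R γ) + lo  ∎
      where open ≤-Reasoning
    walk-lower {lo} {h = h} {γ} {β} {suc k} bd p (R∷ w) = begin
      h β + 2 ^ suc k * lo              ≡⟨ m+n*o+n*o≡m+2*n*o (h β) (2 ^ k) lo ⟨
      h β + 2 ^ k * lo + 2 ^ k * lo     ≤⟨ +-mono-≤ (walk-lower bd (P-R p) w) (proj₁ (T^-bounded k bd (P-L p))) ⟩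
      T^ k h (R γ) + lo + T^ k h (L γ)  ≡⟨ m+n+o≡n+o+m (T^ k h (L γ)) (T^ k h (R γ)) lo ⟨
      T^ k h (L γ) + T^ k h (R γ) + lo  ∎
      where open ≤-Reasoning

    Osc : ℕ → (S → ℕ) → Set
    Osc ε h = ∃[ lo ] Bounded lo (lo + ε) h

    Osc-resp : ∀ {ε f g} → (∀ γ → f γ ≡ g γ) → Osc ε f → Osc ε g
    Osc-resp f≗g (lo , bd) = lo , λ {γ} p →
      subst (lo ≤_) (f≗g γ) (proj₁ (bd p)) , subst (_≤ _) (f≗g γ) (proj₂ (bd p))

    Osc-T^ : ∀ {ε h} k → Osc ε h → Osc (2 ^ k * ε) (T^ k h)
    Osc-T^ {ε} {h} k (lo , bd) = 2 ^ k * lo , λ {γ} p →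
      proj₁ (T^-bounded k bd p) , subst (T^ k h γ ≤_) (*-distribˡ-+ (2 ^ k) lo ε) (proj₂ (T^-bounded k bd p))

    Osc-contract : ∀ {β K ε h} → (∀ {γ} → P γ → Walk γ β K) →
                   Osc ε h → Osc ((2 ^ K ∸ 1) * ε) (T^ K h)
    Osc-contract {β} {K} {ε} {h} walk (lo , bd) = h β + A * lo , λ p → lower p , upper p
      where
      A : ℕ
      A = 2 ^ K ∸ 1
      2^K≡1+A : 2 ^ K ≡ 1 + A
      2^K≡1+A = sym (m+[n∸m]≡n (m^n>0 2 K))
      lower : ∀ {γ} → P γ → h β + A * lo ≤ T^ K h γ
      lower {γ} p = +-cancelʳ-≤ lo _ _ (begin
        h β + A * lo + lo    ≡⟨ +-assoc (h β) (A * lo) lo ⟩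
        h β + (A * lo + lo)  ≡⟨ cong (_+_ (h β)) (+-comm (A * lo) lo) ⟩
        h β + (1 + A) * lo   ≡⟨ cong (λ x → h β + x * lo) 2^K≡1+A ⟨
        h β + 2 ^ K * lo     ≤⟨ walk-lower bd p (walk p) ⟩
        T^ K h γ + lo        ∎)
        where open ≤-Reasoning
      upper : ∀ {γ} → P γ → T^ K h γ ≤ h β + A * lo + A * ε
      upper {γ} p = +-cancelʳ-≤ (lo + ε) _ _ (begin
        T^ K h γ + (lo + ε)               ≤⟨ walk-upper bd p (walk p) ⟩
        h β + 2 ^ K * (lo + ε)            ≡⟨ cong (λ x → h β + x * (lo + ε)) 2^K≡1+A ⟩
        h β + (1 + A) * (lo + ε)          ≡⟨ expand (h β) A lo ε ⟩
        h β + A * lo + A * ε + (lo + ε)   ∎)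
        where
        open ≤-Reasoning
        expand : ∀ x a l e → x + (1 + a) * (l + e) ≡ x + a * l + a * e + (l + e)
        expand = solve-∀

    Osc-T^-blocks : ∀ {β K} → (∀ {γ} → P γ → Walk γ β K) →
                    ∀ {ε h} q j → Osc ε h → Osc ((2 ^ K ∸ 1) ^ q * (2 ^ j * ε)) (T^ (q * K + j) h)
    Osc-T^-blocks walk {ε} {h} zero j osc =
      subst (λ e → Osc e (T^ j h)) (sym (*-identityˡ (2 ^ j * ε))) (Osc-T^ j osc)
    Osc-T^-blocks {K = K} walk {ε} {h} (suc q) j osc =
      subst (λ e → Osc e (T^ (suc q * K + j) h)) (sym (*-assoc (2 ^ K ∸ 1) ((2 ^ K ∸ 1) ^ q) (2 ^ j * ε)))
        (Osc-resp T^-split (Osc-contract walk (Osc-T^-blocks walk q j osc)))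
      where
      T^-split : ∀ γ → T^ K (T^ (q * K + j) h) γ ≡ T^ (K + q * K + j) h γ
      T^-split γ = trans (sym (T^-+ K (q * K + j) h γ)) (cong (λ r → T^ r h γ) (sym (+-assoc K (q * K) j)))

∣n*x-P∣≤n*ε : ∀ {n x P lo ε} → lo ≤ x → x ≤ lo + ε → n * lo ≤ P → P ≤ n * (lo + ε) →
              n * x ≤ P + n * ε × P ≤ n * x + n * ε
∣n*x-P∣≤n*ε {n} {x} {P} {lo} {ε} lo≤x x≤lo+ε n*lo≤P P≤n*[lo+ε] =
  (begin
    n * x             ≤⟨ *-monoʳ-≤ n x≤lo+ε ⟩
    n * (lo + ε)      ≡⟨ *-distribˡ-+ n lo ε ⟩
    n * lo + n * ε    ≤⟨ +-monoˡ-≤ (n * ε) n*lo≤P ⟩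
    P + n * ε         ∎) ,
  (begin
    P                 ≤⟨ P≤n*[lo+ε] ⟩
    n * (lo + ε)      ≡⟨ *-distribˡ-+ n lo ε ⟩
    n * lo + n * ε    ≤⟨ +-monoˡ-≤ (n * ε) (*-monoʳ-≤ n lo≤x) ⟩
    n * x + n * ε     ∎)
  where open ≤-Reasoning

^-distribʳ-* : ∀ m n k → (m * n) ^ k ≡ m ^ k * n ^ k
^-distribʳ-* m n zero    = refl
^-distribʳ-* m n (suc k) = trans (cong (m * n *_) (^-distribʳ-* m n k)) (interchange m n (m ^ k) (n ^ k))
  where
  interchange : ∀ a b c e → a * b * (c * e) ≡ a * c * (b * e)
  interchange = solve-∀

-- (1 − 1/(y+1))ᴷ ≥ 1 − K/(y+1), multiplied by (y+1)ᴷ⁺¹.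
bernoulli : ∀ K y → suc y ^ suc K ≤ suc y * y ^ K + K * suc y ^ K
bernoulli zero    y = ≤-reflexive (sym (+-identityʳ (suc y * 1)))
bernoulli (suc K) y = begin
  suc y * suc y ^ suc K                             ≤⟨ *-monoʳ-≤ (suc y) (bernoulli K y) ⟩
  suc y * (suc y * y ^ K + K * suc y ^ K)           ≡⟨ expand y (y ^ K) K (suc y ^ K) ⟩
  suc y * (y * y ^ K) + suc y * y ^ K + K * (suc y * suc y ^ K)
    ≤⟨ +-monoˡ-≤ (K * (suc y * suc y ^ K)) (+-monoʳ-≤ (suc y * (y * y ^ K)) (*-monoʳ-≤ (suc y) y^K≤[1+y]^K)) ⟩
  suc y * (y * y ^ K) + suc y * suc y ^ K + K * (suc y * suc y ^ K)
    ≡⟨ +-assoc (suc y * (y * y ^ K)) _ _ ⟩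
  suc y * y ^ suc K + suc K * suc y ^ suc K         ∎
  where
  open ≤-Reasoning
  y^K≤[1+y]^K : y ^ K ≤ suc y ^ K
  y^K≤[1+y]^K = ^-monoˡ-≤ K (n≤1+n y)
  expand : ∀ y Y K P → suc y * (suc y * Y + K * P) ≡ suc y * (y * Y) + suc y * Y + K * (suc y * P)
  expand = solve-∀

[2^K∸1]*[1+M]^K≤[1+2M]^K : ∀ K M′ → K * 2 ^ K ≤ M′ → (2 ^ K ∸ 1) * suc M′ ^ K ≤ suc (2 * M′) ^ K
[2^K∸1]*[1+M]^K≤[1+2M]^K K M′ K*2^K≤M′ = *-cancelˡ-≤ (2 * M) (+-cancelʳ-≤ (2 * M * M ^ K) _ _ (begin
  2 * M * (A * M ^ K) + 2 * M * M ^ K   ≡⟨ factor (2 * M) A (M ^ K) ⟩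
  2 * M * ((1 + A) * M ^ K)             ≡⟨ cong (λ x → 2 * M * (x * M ^ K)) 1+A≡2^K ⟩
  2 * M * (2 ^ K * M ^ K)               ≡⟨ cong (2 * M *_) (^-distribʳ-* 2 M K) ⟨
  (2 * M) ^ suc K                       ≡⟨ cong (_^ suc K) 2M≡1+Y ⟩
  suc Y ^ suc K                         ≤⟨ bernoulli K Y ⟩
  suc Y * Y ^ K + K * suc Y ^ K         ≡⟨ cong (λ x → x * Y ^ K + K * x ^ K) 2M≡1+Y ⟨
  2 * M * Y ^ K + K * (2 * M) ^ K       ≡⟨ cong (λ x → 2 * M * Y ^ K + K * x) (^-distribʳ-* 2 M K) ⟩
  2 * M * Y ^ K + K * (2 ^ K * M ^ K)   ≡⟨ cong (_+_ (2 * M * Y ^ K)) (*-assoc K (2 ^ K) (M ^ K)) ⟨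
  2 * M * Y ^ K + K * 2 ^ K * M ^ K     ≤⟨ +-monoʳ-≤ (2 * M * Y ^ K) (*-monoˡ-≤ (M ^ K) K*2^K≤2M) ⟩
  2 * M * Y ^ K + 2 * M * M ^ K         ∎))
  where
  open ≤-Reasoning
  M Y A : ℕ
  M = suc M′
  Y = suc (2 * M′)
  A = 2 ^ K ∸ 1
  1+A≡2^K : 1 + A ≡ 2 ^ K
  1+A≡2^K = m+[n∸m]≡n (m^n>0 2 K)
  2M≡1+Y : 2 * M ≡ suc Y
  2M≡1+Y = *-suc 2 M′
  K*2^K≤2M : K * 2 ^ K ≤ 2 * M
  K*2^K≤2M = ≤-trans K*2^K≤M′ (≤-trans (n≤1+n M′) (m≤n*m M 2))
  factor : ∀ m a p → m * (a * p) + m * p ≡ m * ((1 + a) * p)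
  factor = solve-∀

block-geometric-bound : ∀ {A M Y K} → A * M ^ K ≤ Y ^ K → M ≤ Y → ∀ q {j} → j ≤ K →
                        A ^ q * 2 ^ j * M ^ (q * K + j) ≤ 2 ^ K * Y ^ (q * K + j)
block-geometric-bound {A} {M} {Y} {K} AM^K≤Y^K M≤Y zero {j} j≤K = begin
  1 * 2 ^ j * M ^ j  ≡⟨ cong (_* M ^ j) (*-identityˡ (2 ^ j)) ⟩
  2 ^ j * M ^ j      ≤⟨ *-mono-≤ (^-monoʳ-≤ 2 j≤K) (^-monoˡ-≤ j M≤Y) ⟩
  2 ^ K * Y ^ j      ∎
  where open ≤-Reasoning
block-geometric-bound {A} {M} {Y} {K} AM^K≤Y^K M≤Y (suc q) {j} j≤K = begin
  A ^ suc q * c * M ^ (K + q * K + j)        ≡⟨ cong (A ^ suc q * c *_) (^-split M) ⟩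
  A * A ^ q * c * (M ^ K * M ^ (q * K + j))  ≡⟨ regroup A (A ^ q) c (M ^ K) (M ^ (q * K + j)) ⟩
  A * M ^ K * (A ^ q * c * M ^ (q * K + j))  ≤⟨ *-mono-≤ AM^K≤Y^K (block-geometric-bound AM^K≤Y^K M≤Y q j≤K) ⟩
  Y ^ K * (2 ^ K * Y ^ (q * K + j))          ≡⟨ x*[y*z]≡y*[x*z] (Y ^ K) (2 ^ K) (Y ^ (q * K + j)) ⟩
  2 ^ K * (Y ^ K * Y ^ (q * K + j))          ≡⟨ cong (2 ^ K *_) (^-split Y) ⟨
  2 ^ K * Y ^ (K + q * K + j)                ∎
  where
  open ≤-Reasoning
  c : ℕ
  c = 2 ^ j
  ^-split : ∀ x → x ^ (K + q * K + j) ≡ x ^ K * x ^ (q * K + j)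
  ^-split x = trans (cong (x ^_) (+-assoc K (q * K) j)) (^-distribˡ-+-* x K (q * K + j))
  regroup : ∀ a b c m n → a * b * c * (m * n) ≡ a * m * (b * c * n)
  regroup = solve-∀
  x*[y*z]≡y*[x*z] : ∀ x y z → x * (y * z) ≡ y * (x * z)
  x*[y*z]≡y*[x*z] = solve-∀

p≤q+r⇒p-q≤r : ∀ {p q r} → p ℚ.≤ q ℚ.+ r → p - q ℚ.≤ r
p≤q+r⇒p-q≤r {p} {q} {r} p≤q+r = subst (p - q ℚ.≤_) cancel (ℚ.+-monoˡ-≤ (ℚ.- q) p≤q+r)
  where
  open ≡-Reasoning
  cancel : q ℚ.+ r - q ≡ r
  cancel = begin
    q ℚ.+ r - q          ≡⟨ cong (ℚ._- q) (ℚ.+-comm q r) ⟩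
    r ℚ.+ q - q          ≡⟨ ℚ.+-assoc r q (ℚ.- q) ⟩
    r ℚ.+ (q - q)        ≡⟨ cong (r ℚ.+_) (ℚ.+-inverseʳ q) ⟩
    r ℚ.+ 0ℚ             ≡⟨ ℚ.+-identityʳ r ⟩
    r                    ∎

∣p-q∣≤r : ∀ {p q r} → p ℚ.≤ q ℚ.+ r → q ℚ.≤ p ℚ.+ r → ∣ p - q ∣ ℚ.≤ r
∣p-q∣≤r {p} {q} {r} p≤q+r q≤p+r with ℚ.∣p∣≡p∨∣p∣≡-p (p - q)
... | inj₁ ∣p-q∣≡p-q  = subst (ℚ._≤ r) (sym ∣p-q∣≡p-q) (p≤q+r⇒p-q≤r p≤q+r)
... | inj₂ ∣p-q∣≡-[p-q] =
  subst (ℚ._≤ r) (sym (trans ∣p-q∣≡-[p-q] (⁻¹-anti-homo‿- p q))) (p≤q+r⇒p-q≤r q≤p+r)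

toℚᵘ-frac : ∀ a n .{{_ : NonZero n}} → ℚ.toℚᵘ ((+ a) / n) ℚᵘ.≃ (+ a) ℚᵘ./ n
toℚᵘ-frac a (suc n) = ℚ.toℚᵘ-fromℚᵘ (ℚᵘ.mkℚᵘ (+ a) n)

frac-≤ : ∀ {a b n m} .{{_ : NonZero n}} .{{_ : NonZero m}} → a * m ≤ b * n → (+ a) / n ℚ.≤ (+ b) / m
frac-≤ {a} {b} {n@(suc _)} {m@(suc _)} am≤bn = ℚ.toℚᵘ-cancel-≤
  (ℚᵘ.≤-respˡ-≃ (ℚᵘ.≃-sym (toℚᵘ-frac a n)) (ℚᵘ.≤-respʳ-≃ (ℚᵘ.≃-sym (toℚᵘ-frac b m))
    (ℚᵘ.*≤* (subst₂ ℤ._≤_ (ℤ.pos-* a m) (ℤ.pos-* b n) (ℤ.+≤+ am≤bn)))))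

frac-< : ∀ {a b n m} .{{_ : NonZero n}} .{{_ : NonZero m}} → a * m < b * n → (+ a) / n <ℚ (+ b) / m
frac-< {a} {b} {n@(suc _)} {m@(suc _)} am<bn = ℚ.toℚᵘ-cancel-<
  (ℚᵘ.<-respˡ-≃ (ℚᵘ.≃-sym (toℚᵘ-frac a n)) (ℚᵘ.<-respʳ-≃ (ℚᵘ.≃-sym (toℚᵘ-frac b m))
    (ℚᵘ.*<* (subst₂ ℤ._<_ (ℤ.pos-* a m) (ℤ.pos-* b n) (ℤ.+<+ am<bn)))))

frac-+ : ∀ a b n m .{{_ : NonZero n}} .{{_ : NonZero m}} →
         (+ a) / n ℚ.+ (+ b) / m ≡ ((+ (a * m + b * n)) / (n * m)) ⦃ m*n≢0 n m ⦄
frac-+ a b n@(suc _) m@(suc _) = ℚ.toℚᵘ-injective (begin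
  ℚ.toℚᵘ ((+ a) / n ℚ.+ (+ b) / m)              ≈⟨ ℚ.toℚᵘ-homo-+ ((+ a) / n) ((+ b) / m) ⟩
  ℚ.toℚᵘ ((+ a) / n) ℚᵘ.+ ℚ.toℚᵘ ((+ b) / m)    ≈⟨ ℚᵘ.+-cong (toℚᵘ-frac a n) (toℚᵘ-frac b m) ⟩
  (+ a) ℚᵘ./ n ℚᵘ.+ (+ b) ℚᵘ./ m                ≈⟨ ℚᵘ.≃-reflexive (cong (ℚᵘ._/ (n * m)) numerator) ⟩
  (+ (a * m + b * n)) ℚᵘ./ (n * m)              ≈⟨ toℚᵘ-frac (a * m + b * n) (n * m) ⟨
  ℚ.toℚᵘ ((+ (a * m + b * n)) / (n * m))        ∎)
  where
  open ℚᵘ.≃-Reasoning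
  numerator : + a ℤ.* + m ℤ.+ + b ℤ.* + n ≡ + (a * m + b * n)
  numerator = sym (trans (ℤ.pos-+ (a * m) (b * n)) (cong₂ ℤ._+_ (ℤ.pos-* a m) (ℤ.pos-* b n)))

frac-* : ∀ a b n m .{{_ : NonZero n}} .{{_ : NonZero m}} →
         ((+ a) / n) *ℚ ((+ b) / m) ≡ ((+ (a * b)) / (n * m)) ⦃ m*n≢0 n m ⦄
frac-* a b n@(suc _) m@(suc _) = ℚ.toℚᵘ-injective (begin
  ℚ.toℚᵘ (((+ a) / n) *ℚ ((+ b) / m))            ≈⟨ ℚ.toℚᵘ-homo-* ((+ a) / n) ((+ b) / m) ⟩
  ℚ.toℚᵘ ((+ a) / n) ℚᵘ.* ℚ.toℚᵘ ((+ b) / m)    ≈⟨ ℚᵘ.*-cong (toℚᵘ-frac a n) (toℚᵘ-frac b m) ⟩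
  ((+ a) ℚᵘ./ n) ℚᵘ.* ((+ b) ℚᵘ./ m)
    ≈⟨ ℚᵘ.≃-reflexive (cong (ℚᵘ._/ (n * m)) (sym (ℤ.pos-* a b))) ⟩
  (+ (a * b)) ℚᵘ./ (n * m)                      ≈⟨ toℚᵘ-frac (a * b) (n * m) ⟨
  ℚ.toℚᵘ ((+ (a * b)) / (n * m))                ∎)
  where open ℚᵘ.≃-Reasoning

frac-^ℚ : ∀ a n .{{_ : NonZero n}} r → ((+ a) / n) ^ℚ r ≡ ((+ (a ^ r)) / (n ^ r)) ⦃ m^n≢0 n r ⦄
frac-^ℚ a n zero    = refl
frac-^ℚ a n ⦃ n≢0 ⦄ (suc r) =
  trans (cong ((+ a) / n *ℚ_) (frac-^ℚ a n r)) (frac-* a (a ^ r) n (n ^ r) ⦃ n≢0 ⦄ ⦃ m^n≢0 n r ⦄)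

∣x-P/n∣≤ε : ∀ {n x P ε} → 0 < n → n * x ≤ P + n * ε × P ≤ n * x + n * ε →
            ∣ (+ x) / 1 - P ÷ n ∣ ℚ.≤ (+ ε) / 1
∣x-P/n∣≤ε {n@(suc _)} {x} {P} {ε} _ (nx≤P+nε , P≤nx+nε) = ∣p-q∣≤r
  (subst ((+ x) / 1 ℚ.≤_) (sym (frac-+ P ε n 1)) (frac-≤ {x} {P * 1 + ε * n} (begin
    x * (n * 1)          ≡⟨ x*[n*1]≡n*x x n ⟩
    n * x                ≤⟨ nx≤P+nε ⟩
    P + n * ε            ≡⟨ P+n*ε≡[P*1+ε*n]*1 P n ε ⟩
    (P * 1 + ε * n) * 1  ∎)))
  (subst ((+ P) / n ℚ.≤_) (sym (frac-+ x ε 1 1)) (frac-≤ {P} {x * 1 + ε * 1} (begin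
    P * (1 * 1)          ≡⟨ *-identityʳ P ⟩
    P                    ≤⟨ P≤nx+nε ⟩
    n * x + n * ε        ≡⟨ n*x+n*ε≡[x*1+ε*1]*n n x ε ⟩
    (x * 1 + ε * 1) * n  ∎)))
  where
  open ≤-Reasoning
  x*[n*1]≡n*x : ∀ x n → x * (n * 1) ≡ n * x
  x*[n*1]≡n*x = solve-∀
  P+n*ε≡[P*1+ε*n]*1 : ∀ P n ε → P + n * ε ≡ (P * 1 + ε * n) * 1
  P+n*ε≡[P*1+ε*n]*1 = solve-∀
  n*x+n*ε≡[x*1+ε*1]*n : ∀ n x ε → n * x + n * ε ≡ (x * 1 + ε * 1) * n
  n*x+n*ε≡[x*1+ε*1]*n = solve-∀

ε<cρ^r : ∀ ε c y m .{{_ : NonZero m}} r → ε * m ^ r < c * y ^ r →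
         (+ ε) / 1 <ℚ ((+ c) / 1) *ℚ (((+ y) / m) ^ℚ r)
ε<cρ^r ε c y m r εm^r<cy^r =
  subst ((+ ε) / 1 <ℚ_)
        (sym (trans (cong ((+ c) / 1 *ℚ_) (frac-^ℚ y m r)) (frac-* c (y ^ r) 1 (m ^ r) ⦃ _ ⦄ ⦃ m^n≢0 m r ⦄)))
        (frac-< {ε} {c * y ^ r} ⦃ _ ⦄ ⦃ m*n≢0 1 (m ^ r) ⦃ _ ⦄ ⦃ m^n≢0 m r ⦄ ⦄ (begin-strict
          ε * (1 * m ^ r)   ≡⟨ cong (ε *_) (*-identityˡ (m ^ r)) ⟩
          ε * m ^ r         <⟨ εm^r<cy^r ⟩
          c * y ^ r         ≡⟨ *-identityʳ (c * y ^ r) ⟨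
          c * y ^ r * 1     ∎))
  where open ≤-Reasoning

-- Pairs of residues modulo d

module StateSpace (d-2 : ℕ) where

  d : ℕ
  d = 2 + d-2

  L R : ℕ × ℕ → ℕ × ℕ
  L (a , b) = a , (a + b) % d
  R (a , b) = (a + b) % d , b

  open Transfer L R public

  S-double : ∀ n → S d (n * 2) ≡ L (S d n)
  S-double n = cong₂ _,_ (cong (_% d) (stern-double n))
    (trans (cong (_% d) (stern-double+1 n)) (%-distribˡ-+ (stern n) (stern (suc n)) d))

  S-double+1 : ∀ n → S d (suc (n * 2)) ≡ R (S d n)
  S-double+1 n = cong₂ _,_ (trans (cong (_% d) (stern-double+1 n)) (%-distribˡ-+ (stern n) (stern (suc n)) d))
    (cong (_% d) (stern-double (suc n)))

  S-invariant : (Q : ℕ × ℕ → Set) → Q (0 , 1) →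
                (∀ {γ} → Q γ → Q (L γ)) → (∀ {γ} → Q γ → Q (R γ)) → ∀ n → Q (S d n)
  S-invariant Q Q01 Q-L Q-R = <-rec (Q ∘ S d) step
    where
    step : ∀ n → (∀ {m} → m < n → Q (S d m)) → Q (S d n)
    step n rec with evenOdd n
    ... | even zero    = Q01
    ... | even (suc k) = subst Q (sym (S-double (suc k))) (Q-L (rec (s<s (s≤s (m≤m*n k 2)))))
    ... | odd k        = subst Q (sym (S-double+1 k)) (Q-R (rec (s≤s (m≤m*n k 2))))

  content : ℕ × ℕ → ℕ
  content (a , b) = gcd₃ a b d

  content-L : ∀ γ → content (L γ) ≡ content γ
  content-L (a , b) = gcd₃-+-% a b d

  content-R : ∀ γ → content (R γ) ≡ content γ
  content-R (a , b) = begin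
    gcd₃ ((a + b) % d) b d  ≡⟨ gcd₃-comm ((a + b) % d) b d ⟩
    gcd₃ b ((a + b) % d) d  ≡⟨ cong (λ x → gcd₃ b (x % d) d) (+-comm a b) ⟩
    gcd₃ b ((b + a) % d) d  ≡⟨ gcd₃-+-% b a d ⟩
    gcd₃ b a d              ≡⟨ gcd₃-comm b a d ⟩
    gcd₃ a b d              ∎
    where open ≡-Reasoning

  𝒮 : ℕ × ℕ → Set
  𝒮 (a , b) = a < d × b < d × inSd d a b

  𝒮-L : ∀ {γ} → 𝒮 γ → 𝒮 (L γ)
  𝒮-L {a , b} (a<d , b<d , coprime) = a<d , m%n<n (a + b) d , trans (content-L (a , b)) coprime

  𝒮-R : ∀ {γ} → 𝒮 γ → 𝒮 (R γ)
  𝒮-R {a , b} (a<d , b<d , coprime) = m%n<n (a + b) d , b<d , trans (content-R (a , b)) coprime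

  𝒮-01 : 𝒮 (0 , 1)
  𝒮-01 = z<s , s<s z<s , gcd-zeroˡ d

  𝒮-S : ∀ n → 𝒮 (S d n)
  𝒮-S = S-invariant 𝒮 𝒮-01 𝒮-L 𝒮-R

  L^-iterate : ∀ k {a b} → b < d → iterate L (a , b) k ≡ (a , (k * a + b) % d)
  L^-iterate zero    {a}     b<d = cong (a ,_) (sym (m<n⇒m%n≡m b<d))
  L^-iterate (suc k) {a} {b} b<d = trans (L^-iterate k (m%n<n (a + b) d))
    (cong (a ,_) (trans ([m+n%d]%d≡[m+n]%d (k * a) (a + b) d) (cong (_% d) (regroup k a b))))
    where
    regroup : ∀ k a b → k * a + (a + b) ≡ suc k * a + b
    regroup = solve-∀

  R^-iterate : ∀ k {a b} → a < d → iterate R (a , b) k ≡ ((k * b + a) % d , b)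
  R^-iterate zero    {b = b} a<d = cong (_, b) (sym (m<n⇒m%n≡m a<d))
  R^-iterate (suc k) {a} {b} a<d = trans (R^-iterate k (m%n<n (a + b) d))
    (cong (_, b) (trans ([m+n%d]%d≡[m+n]%d (k * b) (a + b) d) (cong (_% d) (regroup k a b))))
    where
    regroup : ∀ k a b → k * b + (a + b) ≡ suc k * b + a
    regroup = solve-∀

  [d∸1]*a+b%d≡b∸a : ∀ {a b} → a ≤ b → b ∸ a < d → ((d ∸ 1) * a + b) % d ≡ b ∸ a
  [d∸1]*a+b%d≡b∸a {a} {b} a≤b b∸a<d = begin
    ((d ∸ 1) * a + b) % d              ≡⟨ cong (λ x → ((d ∸ 1) * a + x) % d) (sym (m+[n∸m]≡n a≤b)) ⟩
    ((d ∸ 1) * a + (a + (b ∸ a))) % d  ≡⟨ cong (_% d) (regroup d-2 a (b ∸ a)) ⟩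
    (b ∸ a + a * d) % d                ≡⟨ [m+kn]%n≡m%n (b ∸ a) a d ⟩
    (b ∸ a) % d                        ≡⟨ m<n⇒m%n≡m b∸a<d ⟩
    b ∸ a                              ∎
    where
    open ≡-Reasoning
    regroup : ∀ e a c → suc e * a + (a + c) ≡ c + a * (2 + e)
    regroup = solve-∀

  [d∸1]*g%d≡d∸g : ∀ {g} → 0 < g → g ≤ d → ((d ∸ 1) * g + 0) % d ≡ d ∸ g
  [d∸1]*g%d≡d∸g {suc g} _ g≤d = begin
    ((d ∸ 1) * suc g + 0) % d  ≡⟨ cong (_% d) (+-identityʳ ((d ∸ 1) * suc g)) ⟩
    ((d ∸ 1) * suc g) % d      ≡⟨ [m+n]%n≡m%n ((d ∸ 1) * suc g) d ⟨
    ((d ∸ 1) * suc g + d) % d  ≡⟨ [d∸1]*a+b%d≡b∸a g≤d (s≤s (m∸n≤m (suc d-2) g)) ⟩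
    d ∸ suc g                  ∎
    where open ≡-Reasoning

  walk-L-subtract : ∀ {a b} → a ≤ b → b < d → Walk (a , b) (a , b ∸ a) (d ∸ 1)
  walk-L-subtract {a} {b} a≤b b<d = subst (λ β → Walk (a , b) β (d ∸ 1)) L^[d∸1] (walk-L^ (d ∸ 1) (a , b))
    where
    L^[d∸1] : iterate L (a , b) (d ∸ 1) ≡ (a , b ∸ a)
    L^[d∸1] = trans (L^-iterate (d ∸ 1) b<d)
                    (cong (a ,_) ([d∸1]*a+b%d≡b∸a a≤b (≤-<-trans (m∸n≤m b a) b<d)))

  walk-R-subtract : ∀ {a b} → b ≤ a → a < d → Walk (a , b) (a ∸ b , b) (d ∸ 1)
  walk-R-subtract {a} {b} b≤a a<d = subst (λ β → Walk (a , b) β (d ∸ 1)) R^[d∸1] (walk-R^ (d ∸ 1) (a , b))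
    where
    R^[d∸1] : iterate R (a , b) (d ∸ 1) ≡ (a ∸ b , b)
    R^[d∸1] = trans (R^-iterate (d ∸ 1) a<d)
                    (cong (_, b) ([d∸1]*a+b%d≡b∸a b≤a (≤-<-trans (m∸n≤m a b) a<d)))

  d∸1+d*f≤d*[1+f] : ∀ f → d ∸ 1 + d * f ≤ d * suc f
  d∸1+d*f≤d*[1+f] f = ≤-trans (+-monoˡ-≤ (d * f) (n≤1+n (d ∸ 1))) (≤-reflexive (sym (*-suc d f)))

  euclid : ∀ f {a b} → a + b ≤ f → a < d → b < d → (a , b) ⇝[≤ d * f ] (0 , gcd a b)
  euclid f {zero} {b} _ _ _ = 0 , z≤n , subst (λ g → Walk (0 , b) (0 , g) 0) (sym (gcd-identityˡ b)) []
  euclid (suc f) {suc a} {zero} _ a<d _ = ⇝-weaken (m≤m*n d (suc f)) (walk⇒⇝ (L∷ to-[0,1+a]))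
    where
    to-[0,1+a] : Walk (L (suc a , 0)) (0 , gcd (suc a) 0) (d ∸ 1)
    to-[0,1+a] = subst₂ (λ γ β → Walk γ β (d ∸ 1))
      (cong (suc a ,_) (sym (trans (cong (_% d) (+-identityʳ (suc a))) (m<n⇒m%n≡m a<d))))
      (cong₂ _,_ (n∸n≡0 a) (sym (gcd-identityʳ (suc a))))
      (walk-R-subtract ≤-refl a<d)
  euclid (suc f) {suc a} {suc b} (s≤s a+1+b≤f) a<d b<d with suc b ≤? suc a
  ... | yes b≤a = ⇝-weaken (d∸1+d*f≤d*[1+f] f) (walk⇒⇝ (walk-R-subtract b≤a a<d) ⇝++
      subst (λ g → (a ∸ b , suc b) ⇝[≤ d * f ] (0 , g)) (gcd[m∸n,n]≡gcd[m,n] b≤a)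
        (euclid f (≤-trans (+-monoˡ-≤ (suc b) (m∸n≤m a b)) a+1+b≤f) (≤-<-trans (m∸n≤m (suc a) (suc b)) a<d) b<d))
  ... | no b≰a = ⇝-weaken (d∸1+d*f≤d*[1+f] f) (walk⇒⇝ (walk-L-subtract a≤b b<d) ⇝++
      subst (λ g → (suc a , b ∸ a) ⇝[≤ d * f ] (0 , g)) (gcd[m,n∸m]≡gcd[m,n] a≤b)
        (euclid f fuel a<d (≤-<-trans (m∸n≤m (suc b) (suc a)) b<d)))
    where
    a≤b : suc a ≤ suc b
    a≤b = <⇒≤ (≰⇒> b≰a)
    fuel : suc a + (b ∸ a) ≤ f
    fuel = ≤-trans (+-monoʳ-≤ (suc a) (m∸n≤m b a)) (≤-trans (≤-reflexive (sym (+-suc a b))) a+1+b≤f)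

  gcd-pos : ∀ {a b} → inSd d a b → 0 < gcd a b
  gcd-pos {a} {b} coprime with gcd a b
  ... | zero  = contradiction (trans (sym (gcd-identityˡ d)) coprime) λ ()
  ... | suc _ = z<s

  gcd<d : ∀ {a b} → a < d → b < d → gcd a b < d
  gcd<d {a} {zero}  a<d _   = subst (_< d) (sym (gcd-identityʳ a)) a<d
  gcd<d {a} {suc b} _   b<d = ≤-<-trans (gcd[m,n]≤n a (suc b)) b<d

  -- Euclid from (a, b) to (0, g), then R^(d−1) to (d − g, g), then Euclid to (0, gcd(d − g, g)) = (0, 1).
  walkTime : ℕ
  walkTime = d * (d + d) + (d ∸ 1 + d * (d + d))

  reach-01 : ∀ {γ} → 𝒮 γ → γ ⇝[≤ walkTime ] (0 , 1)
  reach-01 {a , b} (a<d , b<d , coprime) =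
    euclid (d + d) (+-mono-≤ (<⇒≤ a<d) (<⇒≤ b<d)) a<d b<d
    ⇝++ walk⇒⇝ to-[d∸g,g]
    ⇝++ subst (λ g′ → (d ∸ g , g) ⇝[≤ d * (d + d) ] (0 , g′)) gcd[d∸g,g]≡1
          (euclid (d + d) fuel (∸-monoʳ-< 0<g (<⇒≤ g<d)) g<d)
    where
    g : ℕ
    g = gcd a b
    0<g : 0 < g
    0<g = gcd-pos {a} {b} coprime
    g<d : g < d
    g<d = gcd<d a<d b<d
    to-[d∸g,g] : Walk (0 , g) (d ∸ g , g) (d ∸ 1)
    to-[d∸g,g] = subst (λ β → Walk (0 , g) β (d ∸ 1))
      (trans (R^-iterate (d ∸ 1) z<s) (cong (_, g) ([d∸1]*g%d≡d∸g 0<g (<⇒≤ g<d))))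
      (walk-R^ (d ∸ 1) (0 , g))
    gcd[d∸g,g]≡1 : gcd (d ∸ g) g ≡ 1
    gcd[d∸g,g]≡1 = trans (gcd[m∸n,n]≡gcd[m,n] (<⇒≤ g<d)) (trans (gcd-comm d g) coprime)
    fuel : d ∸ g + g ≤ d + d
    fuel = ≤-trans (≤-reflexive (m∸n+n≡m (<⇒≤ g<d))) (m≤m+n d d)

  walk-to-01 : ∀ {γ} → 𝒮 γ → Walk γ (0 , 1) walkTime
  walk-to-01 = pad refl ∘ reach-01

  open Oscillation 𝒮 𝒮-L 𝒮-R public

  ∑² : (ℕ × ℕ → ℕ) → ℕ
  ∑² h = ∑[ a < d ] ∑[ b < d ] h (a , b)

  ∑²-cong : ∀ {f g} → (∀ {a b} → a < d → b < d → f (a , b) ≡ g (a , b)) → ∑² f ≡ ∑² g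
  ∑²-cong f≗g = ∑-cong d (λ a<d → ∑-cong d (f≗g a<d))

  ∑²-mono-≤ : ∀ {f g} → (∀ {a b} → a < d → b < d → f (a , b) ≤ g (a , b)) → ∑² f ≤ ∑² g
  ∑²-mono-≤ f≤g = ∑-mono-≤ d (λ a<d → ∑-mono-≤ d (f≤g a<d))

  ∑²-term-≤ : ∀ {a b} h → a < d → b < d → h (a , b) ≤ ∑² h
  ∑²-term-≤ {a} {b} h a<d b<d =
    ≤-trans (∑-term-≤ d (λ b → h (a , b)) b<d) (∑-term-≤ d (λ a → ∑[ b < d ] h (a , b)) a<d)

  ∑²-distrib-+ : ∀ f g → ∑² (λ γ → f γ + g γ) ≡ ∑² f + ∑² g
  ∑²-distrib-+ f g = trans (∑-cong d (λ {a} _ → ∑-distrib-+ d (λ b → f (a , b)) (λ b → g (a , b))))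
                           (∑-distrib-+ d (λ a → ∑[ b < d ] f (a , b)) (λ a → ∑[ b < d ] g (a , b)))

  *-distribˡ-∑² : ∀ c h → c * ∑² h ≡ ∑² (λ γ → c * h γ)
  *-distribˡ-∑² c h = trans (*-distribˡ-∑ d c (λ a → ∑[ b < d ] h (a , b)))
                            (∑-cong d (λ {a} _ → *-distribˡ-∑ d c (λ b → h (a , b))))

  ∑²-swap : ∀ h → ∑² (h ∘ swap) ≡ ∑² h
  ∑²-swap h = ∑-comm d d (λ a b → h (b , a))

  ∑²-L : ∀ h → ∑² (h ∘ L) ≡ ∑² h
  ∑²-L h = ∑-cong d (λ {a} _ → ∑-rotate d a (λ b → h (a , b)))

  R≡swap∘L∘swap : ∀ γ → R γ ≡ swap (L (swap γ))
  R≡swap∘L∘swap (a , b) = cong (λ x → x % d , b) (+-comm a b)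

  ∑²-R : ∀ h → ∑² (h ∘ R) ≡ ∑² h
  ∑²-R h = begin
    ∑² (h ∘ R)                ≡⟨ ∑²-cong (λ {a} {b} _ _ → cong h (R≡swap∘L∘swap (a , b))) ⟩
    ∑² (h ∘ swap ∘ L ∘ swap)  ≡⟨ ∑²-swap (h ∘ swap ∘ L) ⟩
    ∑² (h ∘ swap ∘ L)         ≡⟨ ∑²-L (h ∘ swap) ⟩
    ∑² (h ∘ swap)             ≡⟨ ∑²-swap h ⟩
    ∑² h                      ∎
    where open ≡-Reasoning

  𝟙𝒮 : ℕ × ℕ → ℕ
  𝟙𝒮 γ = 𝟙 (gcd₃ (proj₁ γ) (proj₂ γ) d ≟ 1)

  𝟙𝒮≡1 : ∀ {γ} → 𝒮 γ → 𝟙𝒮 γ ≡ 1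
  𝟙𝒮≡1 {a , b} (_ , _ , coprime) = 𝟙-yes (gcd₃ a b d ≟ 1) coprime

  𝟙𝒮-L : ∀ γ → 𝟙𝒮 (L γ) ≡ 𝟙𝒮 γ
  𝟙𝒮-L γ = cong (λ g → 𝟙 (g ≟ 1)) (content-L γ)

  𝟙𝒮-R : ∀ γ → 𝟙𝒮 (R γ) ≡ 𝟙𝒮 γ
  𝟙𝒮-R γ = cong (λ g → 𝟙 (g ≟ 1)) (content-R γ)

  𝟙𝒮*-mono-≤ : ∀ {a b x y} → a < d → b < d → (𝒮 (a , b) → x ≤ y) →
               𝟙𝒮 (a , b) * x ≤ 𝟙𝒮 (a , b) * y
  𝟙𝒮*-mono-≤ {a} {b} a<d b<d x≤y =
    𝟙*-mono-≤ (gcd₃ a b d ≟ 1) (λ coprime → x≤y (a<d , b<d , coprime))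

  N≡∑²𝟙𝒮 : N d ≡ ∑² 𝟙𝒮
  N≡∑²𝟙𝒮 = begin
    N d
      ≡⟨ length-filter (λ γ → gcd₃ (proj₁ γ) (proj₂ γ) d ≟ 1) (cartesianProduct (upTo d) (upTo d)) ⟩
    sum (map 𝟙𝒮 (cartesianProduct (upTo d) (upTo d)))
      ≡⟨ sum-map-cartesianProduct 𝟙𝒮 (upTo d) (upTo d) ⟩
    sum (map (λ a → sum (map (λ b → 𝟙𝒮 (a , b)) (upTo d))) (upTo d))
      ≡⟨ cong sum (map-cong (λ a → cong sum (map-upTo (λ b → 𝟙𝒮 (a , b)) d)) (upTo d)) ⟩
    sum (map (λ a → ∑[ b < d ] 𝟙𝒮 (a , b)) (upTo d))
      ≡⟨ cong sum (map-upTo (λ a → ∑[ b < d ] 𝟙𝒮 (a , b)) d) ⟩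
    ∑² 𝟙𝒮
      ∎
    where open ≡-Reasoning

  N-pos : 0 < N d
  N-pos = subst (0 <_) (sym N≡∑²𝟙𝒮)
                (subst (_≤ ∑² 𝟙𝒮) (𝟙𝒮≡1 𝒮-01) (∑²-term-≤ 𝟙𝒮 z<s (s<s z<s)))

  ∑²-𝟙𝒮*T^ : ∀ r h → ∑² (λ γ → 𝟙𝒮 γ * T^ r h γ) ≡ 2 ^ r * ∑² (λ γ → 𝟙𝒮 γ * h γ)
  ∑²-𝟙𝒮*T^ zero    h = sym (*-identityˡ _)
  ∑²-𝟙𝒮*T^ (suc r) h = begin
    ∑² (λ γ → 𝟙𝒮 γ * (T^ r h (L γ) + T^ r h (R γ)))  ≡⟨ ∑²-cong (λ {a} {b} _ _ → split (a , b)) ⟩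
    ∑² (λ γ → f (L γ) + f (R γ))                     ≡⟨ ∑²-distrib-+ (f ∘ L) (f ∘ R) ⟩
    ∑² (f ∘ L) + ∑² (f ∘ R)                          ≡⟨ cong₂ _+_ (∑²-L f) (∑²-R f) ⟩
    ∑² f + ∑² f                                      ≡⟨ cong₂ _+_ IH IH ⟩
    2 ^ r * X + 2 ^ r * X                            ≡⟨ double (2 ^ r) X ⟩
    2 ^ suc r * X                                    ∎
    where
    open ≡-Reasoning
    f : ℕ × ℕ → ℕ
    f γ = 𝟙𝒮 γ * T^ r h γ
    X : ℕ
    X = ∑² (λ γ → 𝟙𝒮 γ * h γ)
    IH : ∑² f ≡ 2 ^ r * X
    IH = ∑²-𝟙𝒮*T^ r h
    split : ∀ γ → 𝟙𝒮 γ * (T^ r h (L γ) + T^ r h (R γ)) ≡ f (L γ) + f (R γ)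
    split γ = trans (*-distribˡ-+ (𝟙𝒮 γ) _ _)
      (sym (cong₂ _+_ (cong (_* T^ r h (L γ)) (𝟙𝒮-L γ)) (cong (_* T^ r h (R γ)) (𝟙𝒮-R γ))))
    double : ∀ a x → a * x + a * x ≡ 2 * a * x
    double = solve-∀

  mean-sandwich : ∀ {lo hi f} → Bounded lo hi f →
                  N d * lo ≤ ∑² (λ γ → 𝟙𝒮 γ * f γ) × ∑² (λ γ → 𝟙𝒮 γ * f γ) ≤ N d * hi
  mean-sandwich {lo} {hi} {f} bd = lower , upper
    where
    N*c≡∑² : ∀ c → N d * c ≡ ∑² (λ γ → 𝟙𝒮 γ * c)
    N*c≡∑² c = begin
      N d * c              ≡⟨ cong (_* c) N≡∑²𝟙𝒮 ⟩
      ∑² 𝟙𝒮 * c            ≡⟨ *-comm (∑² 𝟙𝒮) c ⟩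
      c * ∑² 𝟙𝒮            ≡⟨ *-distribˡ-∑² c 𝟙𝒮 ⟩
      ∑² (λ γ → c * 𝟙𝒮 γ)  ≡⟨ ∑²-cong (λ {a} {b} _ _ → *-comm c (𝟙𝒮 (a , b))) ⟩
      ∑² (λ γ → 𝟙𝒮 γ * c)  ∎
      where open ≡-Reasoning
    lower : N d * lo ≤ ∑² (λ γ → 𝟙𝒮 γ * f γ)
    lower = subst (_≤ ∑² (λ γ → 𝟙𝒮 γ * f γ)) (sym (N*c≡∑² lo))
                  (∑²-mono-≤ (λ {a} {b} a<d b<d → 𝟙𝒮*-mono-≤ a<d b<d (proj₁ ∘ bd {a , b})))
    upper : ∑² (λ γ → 𝟙𝒮 γ * f γ) ≤ N d * hi
    upper = subst (∑² (λ γ → 𝟙𝒮 γ * f γ) ≤_) (sym (N*c≡∑² hi))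
                  (∑²-mono-≤ (λ {a} {b} a<d b<d → 𝟙𝒮*-mono-≤ a<d b<d (proj₂ ∘ bd {a , b})))

  δ : ℕ × ℕ → ℕ × ℕ → ℕ
  δ (a , b) γ = 𝟙 ((proj₁ γ ≟ a) ×-dec (proj₂ γ ≟ b))

  ∑²-δ : ∀ {a b} → a < d → b < d → ∑² (δ (a , b)) ≡ 1
  ∑²-δ {a₀} {b₀} a₀<d b₀<d = begin
    ∑[ a < d ] ∑[ b < d ] 𝟙 ((a ≟ a₀) ×-dec (b ≟ b₀))
      ≡⟨ ∑-cong d (λ {a} _ → ∑-cong d (λ {b} _ → 𝟙-×-dec (a ≟ a₀) (b ≟ b₀))) ⟩
    ∑[ a < d ] ∑[ b < d ] (𝟙 (a ≟ a₀) * 𝟙 (b ≟ b₀))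
      ≡⟨ ∑-cong d (λ {a} _ → sym (*-distribˡ-∑ d (𝟙 (a ≟ a₀)) (λ b → 𝟙 (b ≟ b₀)))) ⟩
    ∑[ a < d ] (𝟙 (a ≟ a₀) * ∑[ b < d ] 𝟙 (b ≟ b₀))
      ≡⟨ ∑-cong d (λ {a} _ → cong (𝟙 (a ≟ a₀) *_) (∑-indicator d b₀<d)) ⟩
    ∑[ a < d ] (𝟙 (a ≟ a₀) * 1)
      ≡⟨ ∑-cong d (λ {a} _ → *-identityʳ (𝟙 (a ≟ a₀))) ⟩
    ∑[ a < d ] 𝟙 (a ≟ a₀)
      ≡⟨ ∑-indicator d a₀<d ⟩
    1 ∎
    where open ≡-Reasoning

  𝟙𝒮*δ≡δ : ∀ {α} → 𝒮 α → ∀ γ → 𝟙𝒮 γ * δ α γ ≡ δ α γ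
  𝟙𝒮*δ≡δ {a₀ , b₀} α∈𝒮 (a , b) =
    *-𝟙-absorb ((a ≟ a₀) ×-dec (b ≟ b₀)) {𝟙𝒮 (a , b)} λ { (refl , refl) → 𝟙𝒮≡1 α∈𝒮 }

  ∑²-𝟙𝒮*T^δ : ∀ {α} → 𝒮 α → ∀ r → ∑² (λ γ → 𝟙𝒮 γ * T^ r (δ α) γ) ≡ 2 ^ r
  ∑²-𝟙𝒮*T^δ {α} α∈𝒮@(a<d , b<d , _) r = begin
    ∑² (λ γ → 𝟙𝒮 γ * T^ r (δ α) γ)   ≡⟨ ∑²-𝟙𝒮*T^ r (δ α) ⟩
    2 ^ r * ∑² (λ γ → 𝟙𝒮 γ * δ α γ)  ≡⟨ cong (2 ^ r *_) (∑²-cong λ {a} {b} _ _ → 𝟙𝒮*δ≡δ α∈𝒮 (a , b)) ⟩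
    2 ^ r * ∑² (δ α)                 ≡⟨ cong (2 ^ r *_) (∑²-δ a<d b<d) ⟩
    2 ^ r * 1                        ≡⟨ *-identityʳ (2 ^ r) ⟩
    2 ^ r                            ∎
    where open ≡-Reasoning

  -- Counting windows

  window-count : ∀ α r m → ∑[ k < 2 ^ r ] δ α (S d (2 ^ r * m + k)) ≡ T^ r (δ α) (S d m)
  window-count α zero    m = trans (+-identityʳ (δ α (S d (1 * m + 0))))
                                   (cong (λ n → δ α (S d n)) (trans (+-identityʳ (1 * m)) (*-identityˡ m)))
  window-count α (suc r) m = begin
    ∑[ k < 2 ^ suc r ] g (2 ^ suc r * m + k)
      ≡⟨ cong (λ n → ∑[ k < n ] g (2 ^ suc r * m + k)) (double p) ⟩
    ∑[ k < p + p ] g (2 ^ suc r * m + k)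
      ≡⟨ ∑-+ p p (λ k → g (2 ^ suc r * m + k)) ⟩
    ∑[ k < p ] g (2 ^ suc r * m + k) + ∑[ k < p ] g (2 ^ suc r * m + (p + k))
      ≡⟨ cong₂ _+_ (∑-cong p λ {k} _ → cong g (left-half p m k))
                   (∑-cong p λ {k} _ → cong g (right-half p m k)) ⟩
    ∑[ k < p ] g (p * (m * 2) + k) + ∑[ k < p ] g (p * suc (m * 2) + k)
      ≡⟨ cong₂ _+_ (window-count α r (m * 2)) (window-count α r (suc (m * 2))) ⟩
    T^ r (δ α) (S d (m * 2)) + T^ r (δ α) (S d (suc (m * 2)))
      ≡⟨ cong₂ _+_ (cong (T^ r (δ α)) (S-double m)) (cong (T^ r (δ α)) (S-double+1 m)) ⟩
    T^ (suc r) (δ α) (S d m)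
      ∎
    where
    open ≡-Reasoning
    p : ℕ
    p = 2 ^ r
    g : ℕ → ℕ
    g n = δ α (S d n)
    double : ∀ p → 2 * p ≡ p + p
    double = solve-∀
    left-half : ∀ p m k → 2 * p * m + k ≡ p * (m * 2) + k
    left-half = solve-∀
    right-half : ∀ p m k → 2 * p * m + (p + k) ≡ p * suc (m * 2) + k
    right-half = solve-∀

  B≡T^δ : ∀ a b r m → B d a b (2 ^ r * m) (2 ^ r * (m + 1)) ≡ T^ r (δ (a , b)) (S d m)
  B≡T^δ a b r m = begin
    B d a b U (2 ^ r * (m + 1))
      ≡⟨ length-filter P? (applyUpTo (_+_ U) (2 ^ r * (m + 1) ∸ U)) ⟩
    sum (map (𝟙 ∘ P?) (applyUpTo (_+_ U) (2 ^ r * (m + 1) ∸ U)))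
      ≡⟨ cong sum (map-applyUpTo (_+_ U) (𝟙 ∘ P?) (2 ^ r * (m + 1) ∸ U)) ⟩
    ∑[ k < 2 ^ r * (m + 1) ∸ U ] δ (a , b) (S d (U + k))
      ≡⟨ cong (λ n → ∑[ k < n ] δ (a , b) (S d (U + k))) window-length ⟩
    ∑[ k < 2 ^ r ] δ (a , b) (S d (U + k))
      ≡⟨ window-count (a , b) r m ⟩
    T^ r (δ (a , b)) (S d m)
      ∎
    where
    open ≡-Reasoning
    U : ℕ
    U = 2 ^ r * m
    P? : ∀ n → Dec ((proj₁ (S d n) ≡ a) × (proj₂ (S d n) ≡ b))
    P? n = (proj₁ (S d n) ≟ a) ×-dec (proj₂ (S d n) ≟ b)
    window-length : 2 ^ r * (m + 1) ∸ U ≡ 2 ^ r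
    window-length = begin
      2 ^ r * (m + 1) ∸ U  ≡⟨ cong (_∸ U) (*-distribˡ-+ (2 ^ r) m 1) ⟩
      U + 2 ^ r * 1 ∸ U    ≡⟨ m+n∸m≡n U (2 ^ r * 1) ⟩
      2 ^ r * 1            ≡⟨ *-identityʳ (2 ^ r) ⟩
      2 ^ r                ∎

  errorTerm : ℕ → ℕ
  errorTerm r = (2 ^ walkTime ∸ 1) ^ (r ℕ./ walkTime) * 2 ^ (r % walkTime)

  r/K*K+r%K≡r : ∀ r → r ℕ./ walkTime * walkTime + r % walkTime ≡ r
  r/K*K+r%K≡r r = trans (+-comm _ (r % walkTime)) (sym (m≡m%n+[m/n]*n r walkTime))

  Osc-T^δ : ∀ α r → Osc (errorTerm r) (T^ r (δ α))
  Osc-T^δ α r = subst₂ (λ ε r′ → Osc ε (T^ r′ (δ α)))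
    (cong ((2 ^ walkTime ∸ 1) ^ (r ℕ./ walkTime) *_) (*-identityʳ (2 ^ (r % walkTime))))
    (r/K*K+r%K≡r r)
    (Osc-T^-blocks walk-to-01 (r ℕ./ walkTime) (r % walkTime) Osc-δ)
    where
    Osc-δ : Osc 1 (δ α)
    Osc-δ = 0 , λ {γ} _ → z≤n , 𝟙≤1 ((proj₁ γ ≟ proj₁ α) ×-dec (proj₂ γ ≟ proj₂ α))

  B-near-mean : ∀ {a b} r m → 𝒮 (a , b) → let x = B d a b (2 ^ r * m) (2 ^ r * (m + 1)) in
                N d * x ≤ 2 ^ r + N d * errorTerm r × 2 ^ r ≤ N d * x + N d * errorTerm r
  B-near-mean {a} {b} r m α∈𝒮 rewrite B≡T^δ a b r m =
    ∣n*x-P∣≤n*ε {N d} (proj₁ (bd (𝒮-S m))) (proj₂ (bd (𝒮-S m)))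
      (subst (N d * lo ≤_) (∑²-𝟙𝒮*T^δ α∈𝒮 r) (proj₁ (mean-sandwich bd)))
      (subst (_≤ N d * (lo + errorTerm r)) (∑²-𝟙𝒮*T^δ α∈𝒮 r) (proj₂ (mean-sandwich bd)))
    where
    lo : ℕ
    lo = proj₁ (Osc-T^δ (a , b) r)
    bd : Bounded lo (lo + errorTerm r) (T^ r (δ (a , b)))
    bd = proj₂ (Osc-T^δ (a , b) r)

  -- ρ = (2M′ + 1)/(M′ + 1) satisfies ρᴷ ≥ 2ᴷ − 1 for K = walkTime.
  M′ : ℕ
  M′ = walkTime * 2 ^ walkTime

  errorTerm-bound : ∀ r → errorTerm r * suc M′ ^ r < suc (2 ^ walkTime) * suc (2 * M′) ^ r
  errorTerm-bound r = ≤-<-trans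
    (subst (λ r′ → errorTerm r * suc M′ ^ r′ ≤ 2 ^ walkTime * suc (2 * M′) ^ r′) (r/K*K+r%K≡r r)
      (block-geometric-bound ([2^K∸1]*[1+M]^K≤[1+2M]^K walkTime M′ ≤-refl) (s≤s (m≤n*m M′ 2))
                             (r ℕ./ walkTime) (<⇒≤ (m%n<n r walkTime))))
    (m<n+m (2 ^ walkTime * suc (2 * M′) ^ r) (m^n>0 (suc (2 * M′)) r))

  c ρ : ℚ
  c = (+ suc (2 ^ walkTime)) / 1
  ρ = (+ suc (2 * M′)) / suc M′

  0<c : 0ℚ <ℚ c
  0<c = frac-< {0} {suc (2 ^ walkTime)} {1} {1} z<s

  ρ<2 : ρ <ℚ (+ 2) / 1
  ρ<2 = frac-< {suc (2 * M′)} {2} {suc M′} {1}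
               (≤-reflexive (trans (*-identityʳ (2 + 2 * M′)) (sym (*-suc 2 M′))))

  B-close-to-mean : ∀ {a b} r m → 𝒮 (a , b) →
                    ∣ (+ B d a b (2 ^ r * m) (2 ^ r * (m + 1))) / 1 - (2 ^ r) ÷ N d ∣ <ℚ c *ℚ (ρ ^ℚ r)
  B-close-to-mean r m α∈𝒮 = ℚ.≤-<-trans (∣x-P/n∣≤ε N-pos (B-near-mean r m α∈𝒮))
    (ε<cρ^r (errorTerm r) (suc (2 ^ walkTime)) (suc (2 * M′)) (suc M′) r (errorTerm-bound r))

theorem4p6 : (d : ℕ) → (d≥2 : 2 ≤ d) →
    let instance _ = >-nonZero (≤-trans (s≤s z≤n) d≥2) in
    Σ ℚ λ c → Σ ℚ λ ρ → (0ℚ <ℚ c) × (ρ <ℚ ((+ 2) / 1)) ×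
      ((m a b r : ℕ) → a < d → b < d → inSd d a b →
        ∣ ((+ B d a b ((2 ^ r) * m) ((2 ^ r) * (m + 1))) / 1) - ((2 ^ r) ÷ N d) ∣
          <ℚ (c *ℚ (ρ ^ℚ r)))
theorem4p6 (suc (suc d-2)) (s≤s (s≤s z≤n)) =
  c , ρ , 0<c , ρ<2 , λ m a b r a<d b<d coprime → B-close-to-mean r m (a<d , b<d , coprime)
  where open StateSpace d-2
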